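{- Let $(G_j)_{j\in\mathbb Z}$ be a gibonacci sequence. For all integers $k$ and $s$, $$G_{2k+s}=F_{k+1}^2G_{s+1}+F_k^2G_s-F_{k-1}^2G_{s-1}.$$
   Context: $F_j$ denotes the Fibonacci numbers (for all integers $j$). A gibonacci sequence is a sequence $(G_j)_{j\in\mathbb Z}$ with arbitrary initial values $G_0,G_1$, not both zero, satisfying $G_j=G_{j-1}+G_{j-2}$ for all integers $j$. -}

module Defs where

open import Level using (Level)
open import Data.Nat using (ℕ; zero; suc)
open import Data.Integer using (ℤ; +_; -[1+_])
import Data.Integer as ℤ
open import Data.Product using (_×_)
open import Relation.Nullary using (¬_)
open import Algebra.Bundles using (CommutativeRing)

module _ {c ℓ : Level} (R : CommutativeRing c ℓ) where
  open CommutativeRing R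

  fibℕ : ℕ → Carrier
  fibℕ zero = 0#
  fibℕ (suc zero) = 1#
  fibℕ (suc (suc n)) = fibℕ (suc n) + fibℕ n

  sgn : ℕ → Carrier
  sgn zero = 1#
  sgn (suc n) = - sgn n

  -- Fibonacci numbers for all integers: F_{-n} = (-1)^{n+1} F_n
  fib : ℤ → Carrier
  fib (+ n) = fibℕ n
  fib -[1+ n ] = sgn n * fibℕ (suc n)

  record IsGibonacci (G : ℤ → Carrier) : Set (c Level.⊔ ℓ) where
    field
      recurrence : ∀ (j : ℤ) → G j ≈ G (j ℤ.- + 1) + G (j ℤ.- + 2)
      nonzero    : ¬ (G (+ 0) ≈ 0# × G (+ 1) ≈ 0#)

-- A sequence on ℤ satisfying the Fibonacci recurrence is determined by two consecutive
-- values. Both sides of G(m + n) = F(m + 1) G(n) + F(m) G(n - 1) satisfy the recurrence in m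
-- and agree at m = 0, 1, so this addition formula holds. Applied to G = F it gives the
-- doubling formulas F(2k + 1) = F(k + 1)² + F(k)² and F(2k) = F(k + 1) F(k) + F(k) F(k - 1);
-- applied with m = 2k, and after eliminating F(k + 1) = F(k) + F(k - 1) and
-- G(s + 1) = G(s) + G(s - 1), the claim becomes a polynomial identity.
module Submission where

open import Level using (Level)
open import Algebra.Bundles using (CommutativeRing)
open import Data.Nat using (zero; suc)
open import Data.Integer using (ℤ; +_; -[1+_]) renaming (suc to sucℤ)
import Data.Integer as ℤ
import Data.Integer.Properties as ℤ
open import Data.Integer.Tactic.RingSolver using (solve-∀)
open import Data.Product using (_×_; _,_; proj₁; proj₂)
open import Relation.Binary.PropositionalEquality using (_≡_; cong)
open import Defs

ℤ-induction : ∀ {p} (P : ℤ → Set p) → P (+ 0) →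
              (∀ j → P j → P (sucℤ j)) → (∀ j → P (sucℤ j) → P j) → ∀ j → P j
ℤ-induction P base up down (+ zero)     = base
ℤ-induction P base up down (+ suc n)    = up (+ n) (ℤ-induction P base up down (+ n))
ℤ-induction P base up down -[1+ zero ]  = down -[1+ zero ] base
ℤ-induction P base up down -[1+ suc n ] = down -[1+ suc n ] (ℤ-induction P base up down -[1+ n ])

module _ where
  open import Data.Integer using (_+_; _-_; _*_)

  1+[1+j]-1≡1+j : ∀ j → + 1 + (+ 1 + j) - + 1 ≡ + 1 + j
  1+[1+j]-1≡1+j = solve-∀

  1+[1+j]-2≡j : ∀ j → + 1 + (+ 1 + j) - + 2 ≡ j
  1+[1+j]-2≡j = solve-∀

  1+[1+[j-1]]≡j+1 : ∀ j → + 1 + (+ 1 + (j - + 1)) ≡ j + + 1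
  1+[1+[j-1]]≡j+1 = solve-∀

  1+[j-1]≡j : ∀ j → + 1 + (j - + 1) ≡ j
  1+[j-1]≡j = solve-∀

  j+1-1≡j : ∀ j → j + + 1 - + 1 ≡ j
  j+1-1≡j = solve-∀

  2*k≡k+k : ∀ k → + 2 * k ≡ k + k
  2*k≡k+k = solve-∀

  2*k+1≡k+[k+1] : ∀ k → + 2 * k + + 1 ≡ k + (k + + 1)
  2*k+1≡k+[k+1] = solve-∀

module _ {r ℓ : Level} (R : CommutativeRing r ℓ) where
  open CommutativeRing R
  open import Algebra.Properties.Ring ring using (+-cancelˡ; x≈z//y; -‿involutive; -‿distribˡ-*; -0#≈0#)
  open import Algebra.Solver.Ring.NaturalCoefficients.Default commutativeSemiring
  open import Relation.Binary.Reasoning.Setoid setoid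

  reindex : (X : ℤ → Carrier) {i j : ℤ} → i ≡ j → X i ≈ X j
  reindex X i≡j = reflexive (cong X i≡j)

  Recurrent : (ℤ → Carrier) → Set ℓ
  Recurrent X = ∀ j → X (sucℤ (sucℤ j)) ≈ X (sucℤ j) + X j

  recurrent-unique : ∀ {X Y} → Recurrent X → Recurrent Y →
                     X (+ 0) ≈ Y (+ 0) → X (+ 1) ≈ Y (+ 1) → ∀ j → X j ≈ Y j
  recurrent-unique {X} {Y} rX rY e₀ e₁ j = proj₁ (ℤ-induction Agree (e₀ , e₁) up down j)
    where
    Agree : ℤ → Set ℓ
    Agree j = X j ≈ Y j × X (sucℤ j) ≈ Y (sucℤ j)

    next : ∀ j → Agree j → X (sucℤ (sucℤ j)) ≈ Y (sucℤ (sucℤ j))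
    next j (e , e′) = begin
      X (sucℤ (sucℤ j))  ≈⟨ rX j ⟩
      X (sucℤ j) + X j   ≈⟨ +-cong e′ e ⟩
      Y (sucℤ j) + Y j   ≈⟨ rY j ⟨
      Y (sucℤ (sucℤ j))  ∎

    up : ∀ j → Agree j → Agree (sucℤ j)
    up j agree = proj₂ agree , next j agree

    down : ∀ j → Agree (sucℤ j) → Agree j
    down j (e′ , e″) = +-cancelˡ (X (sucℤ j)) (X j) (Y j) (begin
      X (sucℤ j) + X j   ≈⟨ rX j ⟨
      X (sucℤ (sucℤ j))  ≈⟨ e″ ⟩
      Y (sucℤ (sucℤ j))  ≈⟨ rY j ⟩
      Y (sucℤ j) + Y j   ≈⟨ +-congʳ e′ ⟨
      X (sucℤ j) + Y j   ∎) , e′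

  recurrent-shift : ∀ {X} → Recurrent X → ∀ n → Recurrent (λ m → X (m ℤ.+ n))
  recurrent-shift {X} rX n m = begin
    X (sucℤ (sucℤ m) ℤ.+ n)          ≈⟨ reindex X (suc-+ (sucℤ m)) ⟩
    X (sucℤ (sucℤ m ℤ.+ n))          ≈⟨ reindex X (cong sucℤ (suc-+ m)) ⟩
    X (sucℤ (sucℤ (m ℤ.+ n)))        ≈⟨ rX (m ℤ.+ n) ⟩
    X (sucℤ (m ℤ.+ n)) + X (m ℤ.+ n)  ≈⟨ +-congʳ (reindex X (suc-+ m)) ⟨
    X (sucℤ m ℤ.+ n) + X (m ℤ.+ n)    ∎
    where
    suc-+ : ∀ i → sucℤ i ℤ.+ n ≡ sucℤ (i ℤ.+ n)
    suc-+ i = ℤ.+-assoc (+ 1) i n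

  recurrent-linear : ∀ {X Y} → Recurrent X → Recurrent Y →
                     ∀ a b → Recurrent (λ j → X j * a + Y j * b)
  recurrent-linear {X} {Y} rX rY a b j = begin
    X (sucℤ (sucℤ j)) * a + Y (sucℤ (sucℤ j)) * b  ≈⟨ +-cong (*-congʳ (rX j)) (*-congʳ (rY j)) ⟩
    (X (sucℤ j) + X j) * a + (Y (sucℤ j) + Y j) * b  ≈⟨ regroup (X (sucℤ j)) (X j) (Y (sucℤ j)) (Y j) a b ⟩
    (X (sucℤ j) * a + Y (sucℤ j) * b) + (X j * a + Y j * b) ∎
    where
    regroup : ∀ x₁ x₀ y₁ y₀ a b → (x₁ + x₀) * a + (y₁ + y₀) * b ≈ (x₁ * a + y₁ * b) + (x₀ * a + y₀ * b)
    regroup = solve 6 (λ x₁ x₀ y₁ y₀ a b → (x₁ :+ x₀) :* a :+ (y₁ :+ y₀) :* b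
                                        := (x₁ :* a :+ y₁ :* b) :+ (x₀ :* a :+ y₀ :* b)) refl

  recurrent-around : ∀ {X} → Recurrent X → ∀ j → X (j ℤ.+ + 1) ≈ X j + X (j ℤ.- + 1)
  recurrent-around {X} rX j = begin
    X (j ℤ.+ + 1)                                ≈⟨ reindex X (1+[1+[j-1]]≡j+1 j) ⟨
    X (sucℤ (sucℤ (j ℤ.- + 1)))                   ≈⟨ rX (j ℤ.- + 1) ⟩
    X (sucℤ (j ℤ.- + 1)) + X (j ℤ.- + 1)          ≈⟨ +-congʳ (reindex X (1+[j-1]≡j j)) ⟩
    X j + X (j ℤ.- + 1)                           ∎

  gibonacci-recurrent : ∀ {G} → IsGibonacci R G → Recurrent G
  gibonacci-recurrent {G} isGib j = begin
    G (sucℤ (sucℤ j))                                       ≈⟨ IsGibonacci.recurrence isGib (sucℤ (sucℤ j)) ⟩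
    G (sucℤ (sucℤ j) ℤ.- + 1) + G (sucℤ (sucℤ j) ℤ.- + 2)  ≈⟨ +-cong (reindex G (1+[1+j]-1≡1+j j)) (reindex G (1+[1+j]-2≡j j)) ⟩
    G (sucℤ j) + G j                                        ∎

  x*y+[-x]*[y+z]≈-[x*z] : ∀ x y z → x * y + (- x) * (y + z) ≈ - (x * z)
  x*y+[-x]*[y+z]≈-[x*z] x y z = begin
    x * y + (- x) * (y + z)            ≈⟨ +-congˡ (distribˡ (- x) y z) ⟩
    x * y + ((- x) * y + (- x) * z)    ≈⟨ +-assoc _ _ _ ⟨
    (x * y + (- x) * y) + (- x) * z    ≈⟨ +-congʳ (distribʳ y x (- x)) ⟨
    (x + - x) * y + (- x) * z          ≈⟨ +-congʳ (*-congʳ (-‿inverseʳ x)) ⟩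
    0# * y + (- x) * z                 ≈⟨ +-congʳ (zeroˡ y) ⟩
    0# + (- x) * z                     ≈⟨ +-identityˡ _ ⟩
    (- x) * z                          ≈⟨ -‿distribˡ-* x z ⟨
    - (x * z)                          ∎

  fib-recurrent : Recurrent (fib R)
  fib-recurrent (+ n)                = refl
  fib-recurrent -[1+ 0 ]             = sym (trans (+-identityˡ _) (*-identityˡ 1#))
  fib-recurrent -[1+ 1 ]             = sym (begin
    1# * 1# + (- 1#) * (1# + 0#)  ≈⟨ x*y+[-x]*[y+z]≈-[x*z] 1# 1# 0# ⟩
    - (1# * 0#)                   ≈⟨ -‿cong (zeroʳ 1#) ⟩
    - 0#                          ≈⟨ -0#≈0# ⟩
    0#                            ∎)
  fib-recurrent -[1+ suc (suc n) ] = sym (begin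
    (- s) * (f₁ + f₀) + (- - s) * ((f₁ + f₀) + f₁)  ≈⟨ x*y+[-x]*[y+z]≈-[x*z] (- s) (f₁ + f₀) f₁ ⟩
    - ((- s) * f₁)                                  ≈⟨ -‿cong (-‿distribˡ-* s f₁) ⟨
    - - (s * f₁)                                    ≈⟨ -‿involutive (s * f₁) ⟩
    s * f₁                                          ∎)
    where
    s f₀ f₁ : Carrier
    s = sgn R n
    f₀ = fibℕ R n
    f₁ = fibℕ R (suc n)

  recurrent-+ : ∀ {X} → Recurrent X → ∀ m n →
                X (m ℤ.+ n) ≈ fib R (m ℤ.+ + 1) * X n + fib R m * X (n ℤ.- + 1)
  recurrent-+ {X} rX m n =
    recurrent-unique (recurrent-shift rX n)
                     (recurrent-linear (recurrent-shift fib-recurrent (+ 1)) fib-recurrent (X n) (X (n ℤ.- + 1)))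
                     at-0 at-1 m
    where
    at-0 : X (+ 0 ℤ.+ n) ≈ 1# * X n + 0# * X (n ℤ.- + 1)
    at-0 = trans (reindex X (ℤ.+-identityˡ n))
                 (solve 2 (λ x y → x := con 1 :* x :+ con 0 :* y) refl (X n) (X (n ℤ.- + 1)))

    at-1 : X (+ 1 ℤ.+ n) ≈ (1# + 0#) * X n + 1# * X (n ℤ.- + 1)
    at-1 = begin
      X (+ 1 ℤ.+ n)              ≈⟨ reindex X (ℤ.+-comm (+ 1) n) ⟩
      X (n ℤ.+ + 1)              ≈⟨ recurrent-around rX n ⟩
      X n + X (n ℤ.- + 1)        ≈⟨ solve 2 (λ x y → x :+ y := (con 1 :+ con 0) :* x :+ con 1 :* y) refl (X n) (X (n ℤ.- + 1)) ⟩
      (1# + 0#) * X n + 1# * X (n ℤ.- + 1) ∎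

  module _ (k : ℤ) where
    private
      F : ℤ → Carrier
      F = fib R

    fib-double : F (+ 2 ℤ.* k) ≈ F (k ℤ.+ + 1) * F k + F k * F (k ℤ.- + 1)
    fib-double = trans (reindex F (2*k≡k+k k)) (recurrent-+ fib-recurrent k k)

    fib-double+1 : F (+ 2 ℤ.* k ℤ.+ + 1) ≈ F (k ℤ.+ + 1) * F (k ℤ.+ + 1) + F k * F k
    fib-double+1 = begin
      F (+ 2 ℤ.* k ℤ.+ + 1)                                   ≈⟨ reindex F (2*k+1≡k+[k+1] k) ⟩
      F (k ℤ.+ (k ℤ.+ + 1))                                   ≈⟨ recurrent-+ fib-recurrent k (k ℤ.+ + 1) ⟩
      F (k ℤ.+ + 1) * F (k ℤ.+ + 1) + F k * F (k ℤ.+ + 1 ℤ.- + 1) ≈⟨ +-congˡ (*-congˡ (reindex F (j+1-1≡j k))) ⟩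
      F (k ℤ.+ + 1) * F (k ℤ.+ + 1) + F k * F k               ∎

  recurrent-2k+s : ∀ {G} → Recurrent G → ∀ k s →
    G (+ 2 ℤ.* k ℤ.+ s) ≈ fib R (k ℤ.+ + 1) * fib R (k ℤ.+ + 1) * G (s ℤ.+ + 1) + fib R k * fib R k * G s
                           - fib R (k ℤ.- + 1) * fib R (k ℤ.- + 1) * G (s ℤ.- + 1)
  -- The subtracted term is moved to the left, since the solver only handles ℕ coefficients.
  recurrent-2k+s {G} rG k s = x≈z//y _ _ _ (begin
    G (+ 2 ℤ.* k ℤ.+ s) + c * c * h
      ≈⟨ +-congʳ (recurrent-+ rG (+ 2 ℤ.* k) s) ⟩
    (fib R (+ 2 ℤ.* k ℤ.+ + 1) * g + fib R (+ 2 ℤ.* k) * h) + c * c * h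
      ≈⟨ +-congʳ (+-cong (*-congʳ (fib-double+1 k)) (*-congʳ (fib-double k))) ⟩
    ((a * a + b * b) * g + (a * b + b * c) * h) + c * c * h
      ≈⟨ +-congʳ (+-cong (*-congʳ (+-congʳ (*-cong a≈b+c a≈b+c))) (*-congʳ (+-congʳ (*-congʳ a≈b+c)))) ⟩
    (((b + c) * (b + c) + b * b) * g + ((b + c) * b + b * c) * h) + c * c * h
      ≈⟨ expand b c g h ⟩
    (b + c) * (b + c) * (g + h) + b * b * g
      ≈⟨ +-congʳ (*-cong (*-cong a≈b+c a≈b+c) (recurrent-around rG s)) ⟨
    a * a * G (s ℤ.+ + 1) + b * b * g
      ∎)
    where
    a b c g h : Carrier
    a = fib R (k ℤ.+ + 1)
    b = fib R k
    c = fib R (k ℤ.- + 1)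
    g = G s
    h = G (s ℤ.- + 1)

    a≈b+c : a ≈ b + c
    a≈b+c = recurrent-around fib-recurrent k

    expand : ∀ b c g h → (((b + c) * (b + c) + b * b) * g + ((b + c) * b + b * c) * h) + c * c * h
                         ≈ (b + c) * (b + c) * (g + h) + b * b * g
    expand = solve 4 (λ b c g h →
      (((b :+ c) :* (b :+ c) :+ b :* b) :* g :+ ((b :+ c) :* b :+ b :* c) :* h) :+ c :* c :* h
      := (b :+ c) :* (b :+ c) :* (g :+ h) :+ b :* b :* g) refl

open import Data.Integer using (_+_; _-_; _*_)
open CommutativeRing using (Carrier; _≈_) renaming (_+_ to add; _*_ to mul; _-_ to sub)

proposition21 : ∀ {c ℓ : Level} (R : CommutativeRing c ℓ) (G : ℤ → Carrier R) →
                  IsGibonacci R G →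
                  ∀ (k s : ℤ) →
                    _≈_ R (G (+ 2 * k + s))
                      (sub R (add R (mul R (mul R (fib R (k + + 1)) (fib R (k + + 1))) (G (s + + 1)))
                                    (mul R (mul R (fib R k) (fib R k)) (G s)))
                             (mul R (mul R (fib R (k - + 1)) (fib R (k - + 1))) (G (s - + 1))))
proposition21 R G isGib = recurrent-2k+s R (gibonacci-recurrent R isGib)
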